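{- Let $B\subseteq\mathbb N$ be nonempty, $\theta:B\to\mathcal P^*\mathcal P(\mathbb N)$, $p\subseteq\mathbb N$ and $z\in\mathbb N$. Then $z\in L'(G_\theta)(p)$ if and only if there is a $(z,\theta,p)$-dedicated sight.
   Context: Notation: $ex$ is the (possibly undefined) result of applying the $e$-th partial recursive function to $x$; $\langle\cdot,\cdot\rangle$ is a recursive pairing. For $A,C\subseteq\mathbb N$: $A\wedge C=\{\langle a,c\rangle\mid a\in A,c\in C\}$, $A\to C=\{e\mid\forall a\in A\ (ea\text{ defined and in }C)\}$. $G_\theta(p)=\{\langle n,e\rangle\mid n\in B,\ \exists A\in\theta(n)\,(e\in A\to p)\}$. For $f:\mathcal P(\mathbb N)\to\mathcal P(\mathbb N)$, $L'(f)(p)=\bigcap\{q\subseteq\mathbb N\mid \{0\}\wedge p\subseteq q\text{ and }\{1\}\wedge f(q)\subseteq q\}$. A sight is, inductively, either a thing called NIL, or a pair $(A,\sigma)$ with $A\subseteq\mathbb N$ and $\sigma$ a function on $A$ such that each $\sigma(a)$ is a sight. A sight $S$ is $(z,\theta,p)$-dedicated if either $S=\mathrm{NIL}$ and $z\in\{0\}\wedge p$, or $S=(A,\sigma)$, $z=\langle 1,\langle n,e\rangle\rangle$ with $n\in B$, $A\in\theta(n)$, and for all $a\in A$, $ea$ is defined and $\sigma(a)$ is $(ea,\theta,p)$-dedicated. -}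

module Defs where

open import Level using (Level; _⊔_; 0ℓ) renaming (suc to lsuc)
open import Data.Nat using (ℕ; zero; suc; _+_)
open import Data.Product using (Σ; _×_; _,_)
open import Relation.Binary.PropositionalEquality using (_≡_)

Sub : (ℓ : Level) → Set (lsuc ℓ)
Sub ℓ = ℕ → Set ℓ

_⊆_ : ∀ {a b} → Sub a → Sub b → Set (a ⊔ b)
P ⊆ Q = ∀ z → P z → Q z

Sng : ℕ → Sub 0ℓ
Sng k z = z ≡ k

-- A concrete recursive pairing: the Cantor pairing ⟨a,c⟩ = T(a+c) + c,
-- with T the triangular numbers.
tri : ℕ → ℕ
tri zero = 0
tri (suc n) = suc n + tri n

⟨_,_⟩ : ℕ → ℕ → ℕ
⟨ a , c ⟩ = tri (a + c) + c

-- Partial application "e x is defined and equals y" is given as a relation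
-- App e x y (the graph of Kleene application).
AppRel : Set₁
AppRel = ℕ → ℕ → ℕ → Set

Functional : AppRel → Set
Functional App = ∀ e x y y' → App e x y → App e x y' → y ≡ y'

_∧_ : ∀ {a b} → Sub a → Sub b → Sub (a ⊔ b)
(A ∧ C) z = Σ ℕ λ a → Σ ℕ λ c → A a × C c × z ≡ ⟨ a , c ⟩

Arrow : ∀ {a b} → AppRel → Sub a → Sub b → Sub (a ⊔ b)
Arrow App A C e = ∀ x → A x → Σ ℕ λ y → App e x y × C y

-- θ : B → P*P(ℕ) is represented by  θ n b A  ("A ∈ θ(n)", for b : n ∈ B).
Theta : Sub 0ℓ → Set₁
Theta B = (n : ℕ) → B n → (ℕ → Set) → Set

ThetaNonempty : (B : Sub 0ℓ) → Theta B → Set₁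
ThetaNonempty B θ = (n : ℕ) → (b : B n) → Σ (ℕ → Set) λ A → θ n b A

G : AppRel → (B : Sub 0ℓ) → Theta B → Sub (lsuc 0ℓ) → Sub (lsuc 0ℓ)
G App B θ p z =
  Σ ℕ λ n → Σ ℕ λ e → z ≡ ⟨ n , e ⟩ ×
    Σ (B n) λ b → Σ (ℕ → Set) λ A → θ n b A × Arrow App A p e

L' : (Sub (lsuc 0ℓ) → Sub (lsuc 0ℓ)) → Sub (lsuc 0ℓ) → Sub (lsuc (lsuc 0ℓ))
L' f p z = (q : Sub (lsuc 0ℓ)) → (Sng 0 ∧ p) ⊆ q → (Sng 1 ∧ f q) ⊆ q → q z

data Sight : Set₁ where
  NIL  : Sight
  node : (A : ℕ → Set) → ((a : ℕ) → A a → Sight) → Sight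

Dedicated : AppRel → (B : Sub 0ℓ) → Theta B → Sub (lsuc 0ℓ) → ℕ → Sight → Set₁
Dedicated App B θ p z NIL = (Sng 0 ∧ p) z
Dedicated App B θ p z (node A σ) =
  Σ ℕ λ n → Σ ℕ λ e → z ≡ ⟨ 1 , ⟨ n , e ⟩ ⟩ ×
    Σ (B n) λ b → θ n b A ×
      ((a : ℕ) → (h : A a) →
        Σ ℕ λ y → App e a y × Dedicated App B θ p y (σ a h))

-- L'(G_θ)(p) is the least set closed under the rules {0} ∧ p ⊆ q and
-- {1} ∧ G_θ(q) ⊆ q, and a dedicated sight is a well-founded derivation of
-- membership by these rules.  The set of z having a dedicated sight is itself
-- closed under the rules, hence contains L'(G_θ)(p); conversely every closed q
-- contains it, by induction on the sight.
module Submission where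

open import Defs
open import Data.Nat using (ℕ)
open import Data.Product using (Σ; _×_; _,_)
open import Function.Bundles using (_⇔_; mk⇔)
open import Relation.Binary.PropositionalEquality using (refl)

module _ (App : AppRel) (B : ℕ → Set) (θ : Theta B) (p : ℕ → Set₁) where

  HasDedicatedSight : ℕ → Set₁
  HasDedicatedSight z = Σ Sight (Dedicated App B θ p z)

  nil-dedicated : (Sng 0 ∧ p) ⊆ HasDedicatedSight
  nil-dedicated z d = NIL , d

  node-dedicated : (Sng 1 ∧ G App B θ HasDedicatedSight) ⊆ HasDedicatedSight
  node-dedicated _ (_ , _ , refl , (n , e , refl , b , A , A∈θn , e∈A→sighted) , refl) =
    node A subsight , n , e , refl , b , A∈θn , dedicated-at
    where
    subsight : (a : ℕ) → A a → Sight
    subsight a a∈A = let (_ , _ , S , _) = e∈A→sighted a a∈A in S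

    dedicated-at : (a : ℕ) (a∈A : A a) →
                   Σ ℕ λ y → App e a y × Dedicated App B θ p y (subsight a a∈A)
    dedicated-at a a∈A = let (y , ea≡y , _ , d) = e∈A→sighted a a∈A in y , ea≡y , d

  dedicated⇒closed-member : (q : ℕ → Set₁) →
                            (Sng 0 ∧ p) ⊆ q → (Sng 1 ∧ G App B θ q) ⊆ q →
                            (S : Sight) (z : ℕ) → Dedicated App B θ p z S → q z
  dedicated⇒closed-member q nil-closed node-closed NIL z d = nil-closed z d
  dedicated⇒closed-member q nil-closed node-closed (node A σ) z
                          (n , e , refl , b , A∈θn , dedicated-at) =
    node-closed z (1 , ⟨ n , e ⟩ , refl , (n , e , refl , b , A , A∈θn , e∈A→q) , refl)
    where
    e∈A→q : Arrow App A q e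
    e∈A→q a a∈A = let (y , ea≡y , d) = dedicated-at a a∈A in
      y , ea≡y , dedicated⇒closed-member q nil-closed node-closed (σ a a∈A) y d

proposition4p4 : (App : AppRel) → Functional App →
    (B : ℕ → Set) → Σ ℕ B →
    (θ : Theta B) → ThetaNonempty B θ →
    (p : ℕ → Set₁) → (z : ℕ) →
    L' (G App B θ) p z ⇔ Σ Sight (Dedicated App B θ p z)
proposition4p4 App _ B _ θ _ p z = mk⇔ least-closed⇒dedicated dedicated⇒least-closed
  where
  least-closed⇒dedicated : L' (G App B θ) p z → HasDedicatedSight App B θ p z
  least-closed⇒dedicated z∈L' =
    z∈L' (HasDedicatedSight App B θ p) (nil-dedicated App B θ p) (node-dedicated App B θ p)

  dedicated⇒least-closed : HasDedicatedSight App B θ p z → L' (G App B θ) p z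
  dedicated⇒least-closed (S , d) q nil-closed node-closed =
    dedicated⇒closed-member App B θ p q nil-closed node-closed S z d
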